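{- Let $i,j,z\in\mathbb{N}$ and let $Y$ be any Young diagram with $z$ steps. Then $Y$ admits an $(i,j)$-local cover if and only if $Y_z$ admits an $(i,j)$-local cover consisting of exactly $z$ rectangles.
   Context: $\mathbb{N}=\{1,2,\dots\}$ and $[x]=\{1,\dots,x\}$. A Young diagram with $r$ rows and $c$ columns is a set $Y\subseteq [r]\times[c]$ such that whenever $(i,j)\in Y$, then $(i-1,j)\in Y$ if $i\ge 2$ and $(i,j-1)\in Y$ if $j\ge 2$. A (generalized) rectangle in $Y$ is a set $R=S\times T$ with $S\subseteq[r]$, $T\subseteq[c]$ and $R\subseteq Y$; it uses the rows in $S$ and the columns in $T$. A cover of $Y$ is a set $C$ of rectangles in $Y$ with $\bigcup_{R\in C}R=Y$. A cover is $(i,j)$-local if each row of $Y$ is used by at most $i$ rectangles of $C$ and each column of $Y$ is used by at most $j$ rectangles of $C$. The steps of $Y$ are the cells $(s,t)\in Y$ with $(s+1,t)\notin Y$ and $(s,t+1)\notin Y$. $Y_z=\{(s,t)\in[z]\times[z] : s+t\le z+1\}$ denotes the Young diagram with $z$ rows, $z$ columns and $z$ steps. -}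

module Defs where

open import Data.Bool using (Bool; true; false; T; _∧_; not)
open import Data.Nat using (ℕ; zero; suc; _+_; _≤_; _<_; _<?_)
open import Data.Fin using (Fin; toℕ; fromℕ<)
open import Data.Fin.Subset using (Subset; _∈_)
open import Data.Fin.Subset.Properties using (_∈?_)
open import Data.List using (List; length; filterᵇ; cartesianProduct; allFin)
open import Data.List.Relation.Unary.All using (All)
open import Data.List.Relation.Unary.Any using (Any)
open import Data.List.Relation.Unary.Unique.Propositional using (Unique)
open import Data.Product using (_×_; _,_; proj₁; proj₂; Σ)
open import Relation.Binary.PropositionalEquality using (_≡_)
open import Relation.Nullary.Decidable using (⌊_⌋; does; yes; no)

-- Cells are 0-indexed: paper's cell (s,t) ∈ [r]×[c] is (Fin r × Fin c) with
-- toℕ = s - 1, toℕ = t - 1.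

Diagram : ℕ → ℕ → Set
Diagram r c = Fin r → Fin c → Bool

memℕ : ∀ {r c} → Diagram r c → ℕ → ℕ → Bool
memℕ {r} {c} Y s t with s <? r | t <? c
... | yes s<r | yes t<c = Y (fromℕ< s<r) (fromℕ< t<c)
... | _ | _ = false

IsYoung : ∀ {r c} → Diagram r c → Set
IsYoung {r} {c} Y =
  (∀ (a a' : Fin r) (b : Fin c) → suc (toℕ a') ≡ toℕ a → Y a b ≡ true → Y a' b ≡ true) ×
  (∀ (a : Fin r) (b b' : Fin c) → suc (toℕ b') ≡ toℕ b → Y a b ≡ true → Y a b' ≡ true)

isStepᵇ : ∀ {r c} → Diagram r c → Fin r × Fin c → Bool
isStepᵇ Y (a , b) =
  Y a b ∧ not (memℕ Y (suc (toℕ a)) (toℕ b)) ∧ not (memℕ Y (toℕ a) (suc (toℕ b)))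

numSteps : ∀ {r c} → Diagram r c → ℕ
numSteps {r} {c} Y = length (filterᵇ (isStepᵇ Y) (cartesianProduct (allFin r) (allFin c)))

-- The staircase Y_z = {(s,t) : s + t ≤ z + 1} (1-indexed), i.e. toℕ s + toℕ t < z.
Yz : (z : ℕ) → Diagram z z
Yz z a b = ⌊ toℕ a + toℕ b <? z ⌋

Rect : ℕ → ℕ → Set
Rect r c = Subset r × Subset c

IsRectIn : ∀ {r c} → Diagram r c → Rect r c → Set
IsRectIn Y (S , T) = ∀ a b → a ∈ S → b ∈ T → Y a b ≡ true

rowUse : ∀ {r c} → List (Rect r c) → Fin r → ℕ
rowUse C a = length (filterᵇ (λ R → does (a ∈? proj₁ R)) C)

colUse : ∀ {r c} → List (Rect r c) → Fin c → ℕ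
colUse C b = length (filterᵇ (λ R → does (b ∈? proj₂ R)) C)

-- C (a finite set of rectangles, as a duplicate-free list) is a cover of Y.
IsCover : ∀ {r c} → Diagram r c → List (Rect r c) → Set
IsCover {r} {c} Y C =
  Unique C ×
  All (IsRectIn Y) C ×
  (∀ (a : Fin r) (b : Fin c) → Y a b ≡ true → Any (λ R → a ∈ proj₁ R × b ∈ proj₂ R) C)

IsLocalCover : ℕ → ℕ → ∀ {r c} → Diagram r c → List (Rect r c) → Set
IsLocalCover i j {r} {c} Y C =
  IsCover Y C × (∀ (a : Fin r) → rowUse C a ≤ i) × (∀ (b : Fin c) → colUse C b ≤ j)

HasLocalCover : ℕ → ℕ → ∀ {r c} → Diagram r c → Set
HasLocalCover i j {r} {c} Y = Σ (List (Rect r c)) (IsLocalCover i j Y)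

-- Let z be the number of steps of Y, rowRank s the number of steps in the rows above row s and
-- colRank t the number of steps in the columns left of column t. A step is a maximal cell of Y and
-- every cell of Y lies weakly above-left of some step, so for (s,t) ∈ Y no step is both above and
-- left of it while some step is neither; for (s,t) ∉ Y every step is above or left of it. Hence
-- (s,t) ∈ Y iff rowRank s + colRank t < z: Y is the pullback of Y_z along the ranks. Every row and
-- every column holds at most one step, so the ranks climb by at most 1 from 0 to z and are onto
-- {0,…,z-1}.
--
-- Pulling rectangles back along the ranks turns a local cover of Y_z into one of Y. Pulling back
-- along sections of the ranks turns a local cover of Y into a local family of rectangles covering
-- Y_z; regrouping that family by the last row m of each rectangle gives z distinct rectangles
-- (the m-th contains row m and no later row) that still lie in Y_z and use every row and column
-- at most as often as the family does.

module Submission where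

open import Defs
open import Data.Bool using (Bool; true; false; T; not; _∧_)
open import Data.Bool.Properties using (T-≡; T-not-≡; T-∧; not-¬; ∧-zeroʳ)
open import Data.Empty using (⊥-elim)
open import Data.Fin using (Fin; toℕ; fromℕ<; opposite)
open import Data.Fin.Properties using (toℕ-fromℕ<; fromℕ<-toℕ; toℕ<n; toℕ-injective; opposite-prop)
open import Data.Fin.Subset using (Subset; _∈_; ⋃)
open import Data.Fin.Subset.Properties using (_∈?_; ⊆-antisym; x∈p∪q⁺; x∈p∪q⁻; ∉⊥)
open import Data.List using (List; []; _∷_; _++_; length; map; filter; filterᵇ; cartesianProduct; allFin)
open import Data.List.Extrema.Nat using (max; xs≤max; argmax-sel)
open import Data.List.Membership.Propositional using (find; lose) renaming (_∈_ to _∈ₗ_)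
open import Data.List.Membership.Propositional.Properties
  using (∈-length; ∈-map⁺; ∈-map⁻; ∈-filter⁺; ∈-filter⁻; ∈-∃++; ∈-++⁺ˡ; ∈-++⁺ʳ; ∈-++⁻;
         ∈-cartesianProduct⁺; ∈-allFin)
open import Data.List.Properties using (length-map; length-++-sucʳ; filter-none; length-tabulate)
open import Data.List.Relation.Binary.Subset.Propositional using (_⊆_)
open import Data.List.Relation.Unary.All as All using (All; _∷_)
import Data.List.Relation.Unary.All.Properties as All
open import Data.List.Relation.Unary.AllPairs using ([]; _∷_)
open import Data.List.Relation.Unary.Any using (Any; here; there)
import Data.List.Relation.Unary.Any as Any
import Data.List.Relation.Unary.Any.Properties as Any
open import Data.List.Relation.Unary.Unique.Propositional using (Unique)
import Data.List.Relation.Unary.Unique.Propositional.Properties as Unique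
open import Data.Nat
  using (ℕ; zero; suc; _+_; _≤_; _<_; _<ᵇ_; _<?_; _≟_; _≤′_; ≤′-refl; ≤′-step; z≤n; s≤s; s≤s⁻¹)
open import Data.Nat.Properties
open import Data.Product using (∃; Σ; _×_; _,_; proj₁; proj₂)
open import Data.Sum using (inj₁; inj₂)
open import Data.Unit using (tt)
open import Data.Vec using (tabulate)
open import Data.Vec.Properties using (lookup∘tabulate; lookup⇒[]=; []=⇒lookup)
open import Function using (_∘_; id)
open import Function.Bundles using (Equivalence; _⇔_; mk⇔)
open import Relation.Binary.PropositionalEquality using (_≡_; refl; sym; trans; cong; cong₂; subst; subst₂)
open import Relation.Nullary using (Dec; yes; no; does; ¬_)
open import Relation.Nullary.Decidable using (T?; _×-dec_; isYes≗does; dec-true; dec-false)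

open Equivalence using (to; from)

private variable
  A B C : Set

count : (A → Bool) → List A → ℕ
count p xs = length (filterᵇ p xs)

count-mono : {p q : A → Bool} (xs : List A) → (∀ x → T (p x) → T (q x)) → count p xs ≤ count q xs
count-mono [] _ = z≤n
count-mono {p = p} {q} (x ∷ xs) p⇒q with p x in px | q x in qx
... | true  | true  = s≤s (count-mono xs p⇒q)
... | false | true  = m≤n⇒m≤1+n (count-mono xs p⇒q)
... | false | false = count-mono xs p⇒q
... | true  | false = ⊥-elim (subst T qx (p⇒q x (subst T (sym px) tt)))

count-split : (p q : A → Bool) (xs : List A) →
  count p xs ≡ count (λ x → p x ∧ q x) xs + count (λ x → p x ∧ not (q x)) xs
count-split p q [] = refl
count-split p q (x ∷ xs) with p x | q x
... | true  | true  = cong suc (count-split p q xs)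
... | true  | false = trans (cong suc (count-split p q xs)) (sym (+-suc _ _))
... | false | _     = count-split p q xs

count-pos : {p : A → Bool} {x : A} {xs : List A} → x ∈ₗ xs → T (p x) → 0 < count p xs
count-pos {p = p} x∈xs px = ∈-length (∈-filter⁺ (T? ∘ p) x∈xs px)

count-none : {p : A → Bool} (xs : List A) → (∀ x → ¬ T (p x)) → count p xs ≡ 0
count-none {p = p} xs ¬p = cong length (filter-none (T? ∘ p) (All.universal ¬p xs))

count-cong : {p q : A → Bool} (xs : List A) → (∀ x → p x ≡ q x) → count p xs ≡ count q xs
count-cong [] _ = refl
count-cong {q = q} (x ∷ xs) p≗q rewrite p≗q x with q x
... | true  = cong suc (count-cong xs p≗q)
... | false = count-cong xs p≗q

count-map : (p : B → Bool) (f : A → B) (xs : List A) → count p (map f xs) ≡ count (p ∘ f) xs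
count-map p f [] = refl
count-map p f (x ∷ xs) with p (f x)
... | true  = cong suc (count-map p f xs)
... | false = count-map p f xs

unique-⊆⇒length≤ : {xs ys : List A} → Unique xs → xs ⊆ ys → length xs ≤ length ys
unique-⊆⇒length≤ [] _ = z≤n
unique-⊆⇒length≤ {xs = x ∷ xs} (x∉xs ∷ unique) xs⊆ys with ∈-∃++ (xs⊆ys (here refl))
... | us , vs , refl =
  ≤-trans (s≤s (unique-⊆⇒length≤ unique xs⊆us++vs)) (≤-reflexive (sym (length-++-sucʳ us x vs)))
  where
  xs⊆us++vs : xs ⊆ us ++ vs
  xs⊆us++vs {y} y∈xs with ∈-++⁻ us (xs⊆ys (there y∈xs))
  ... | inj₁ y∈us         = ∈-++⁺ˡ y∈us
  ... | inj₂ (here refl)  = ⊥-elim (All.lookup x∉xs y∈xs refl)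
  ... | inj₂ (there y∈vs) = ∈-++⁺ʳ us y∈vs

count≤count-via : {p : A → Bool} {q : B → Bool} {xs : List A} {ys : List B}
  (k : A → C) (h : B → C) → (∀ {x x'} → k x ≡ k x' → x ≡ x') → Unique xs →
  (∀ {x} → x ∈ₗ xs → T (p x) → ∃ λ y → y ∈ₗ ys × T (q y) × h y ≡ k x) →
  count p xs ≤ count q ys
count≤count-via {p = p} {q} {xs} {ys} k h k-injective unique witness = begin
  count p xs                      ≡⟨ sym (length-map k (filterᵇ p xs)) ⟩
  length (map k (filterᵇ p xs))   ≤⟨ unique-⊆⇒length≤ k[p-xs]-unique ⊆ ⟩
  length (map h (filterᵇ q ys))   ≡⟨ length-map h (filterᵇ q ys) ⟩
  count q ys                      ∎
  where
  open ≤-Reasoning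
  k[p-xs]-unique : Unique (map k (filterᵇ p xs))
  k[p-xs]-unique = Unique.map⁺ k-injective (Unique.filter⁺ (T? ∘ p) unique)
  ⊆ : map k (filterᵇ p xs) ⊆ map h (filterᵇ q ys)
  ⊆ v∈ with ∈-map⁻ k v∈
  ... | x , x∈ , refl with ∈-filter⁻ (T? ∘ p) x∈
  ... | x∈xs , px with witness x∈xs px
  ... | y , y∈ys , qy , hy≡kx =
    subst (_∈ₗ map h (filterᵇ q ys)) hy≡kx (∈-map⁺ h (∈-filter⁺ (T? ∘ q) y∈ys qy))

count≤1 : {p : A → Bool} (xs : List A) → Unique xs → (∀ {x y} → T (p x) → T (p y) → x ≡ y) →
  count p xs ≤ 1
count≤1 {p = p} xs unique p-unique = length≤1 (Unique.filter⁺ (T? ∘ p) unique)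
  λ x∈ y∈ → p-unique (proj₂ (∈-filter⁻ (T? ∘ p) {xs = xs} x∈))
                     (proj₂ (∈-filter⁻ (T? ∘ p) {xs = xs} y∈))
  where
  length≤1 : {ys : List A} → Unique ys → (∀ {x y} → x ∈ₗ ys → y ∈ₗ ys → x ≡ y) → length ys ≤ 1
  length≤1 [] _ = z≤n
  length≤1 (_ ∷ []) _ = ≤-refl
  length≤1 ((x≢y ∷ _) ∷ _) allEqual = ⊥-elim (x≢y (allEqual (here refl) (there (here refl))))

<ᵇ-true : ∀ {m n} → m < n → (m <ᵇ n) ≡ true
<ᵇ-true m<n = to T-≡ (<⇒<ᵇ m<n)

<ᵇ-false : ∀ {m n} → n ≤ m → (m <ᵇ n) ≡ false
<ᵇ-false {m} {n} n≤m with m <ᵇ n in m<ᵇn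
... | false = refl
... | true  = ⊥-elim (≤⇒≯ n≤m (<ᵇ⇒< m n (subst T (sym m<ᵇn) tt)))

≥⇒≮ᵇ : ∀ {m n} → n ≤ m → T (not (m <ᵇ n))
≥⇒≮ᵇ = from T-not-≡ ∘ <ᵇ-false

≮ᵇ⇒≥ : ∀ {m n} → T (not (m <ᵇ n)) → n ≤ m
≮ᵇ⇒≥ m≮ᵇn = ≮⇒≥ λ m<n → subst T (to T-not-≡ m≮ᵇn) (<⇒<ᵇ m<n)

∃-last-true : (P : ℕ → Bool) (n : ℕ) → (∀ k → P k ≡ true → k < n) →
  ∀ {s} → P s ≡ true → ∃ λ s' → s ≤ s' × P s' ≡ true × P (suc s') ≡ false
∃-last-true P n bounded {s} = go n s (m≤m+n n s)
  where
  go : ∀ d s → n ≤ d + s → P s ≡ true → ∃ λ s' → s ≤ s' × P s' ≡ true × P (suc s') ≡ false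
  go zero    s n≤s Ps = ⊥-elim (<⇒≱ (bounded s Ps) n≤s)
  go (suc d) s n≤d+s+1 Ps with P (suc s) in Ps+1
  ... | false = s , ≤-refl , Ps , Ps+1
  ... | true  with go d (suc s) (≤-trans n≤d+s+1 (≤-reflexive (sym (+-suc d s)))) Ps+1
  ...   | s' , s<s' , Ps' , ¬Ps'+1 = s' , <⇒≤ s<s' , Ps' , ¬Ps'+1

discrete-ivt : (f : ℕ → ℕ) (n : ℕ) → (∀ s → f (suc s) ≤ suc (f s)) →
  ∀ {k} → f 0 ≤ k → k < f n → ∃ λ s → s < n × f s ≡ k
discrete-ivt f zero    _    f0≤k k<f0 = ⊥-elim (<⇒≱ k<f0 f0≤k)
discrete-ivt f (suc n) step {k} f0≤k k<fn+1 with k <? f n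
... | yes k<fn = let s , s<n , fs≡k = discrete-ivt f n step f0≤k k<fn in s , ≤-trans s<n (n≤1+n n) , fs≡k
... | no k≮fn  = n , ≤-refl , ≤-antisym (≮⇒≥ k≮fn) (s≤s⁻¹ (≤-trans k<fn+1 (step n)))

does⁻ : (d : Dec A) → does d ≡ true → A
does⁻ (yes a) _ = a

module _ {n} {h : Fin n → Bool} {x : Fin n} where

  ∈-tabulate⁺ : h x ≡ true → x ∈ tabulate h
  ∈-tabulate⁺ hx = lookup⇒[]= x (tabulate h) (trans (lookup∘tabulate h x) hx)

  ∈-tabulate⁻ : x ∈ tabulate h → h x ≡ true
  ∈-tabulate⁻ x∈ = trans (sym (lookup∘tabulate h x)) ([]=⇒lookup x∈)

does-∈?-tabulate : ∀ {n} (h : Fin n → Bool) x → does (x ∈? tabulate h) ≡ h x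
does-∈?-tabulate h x with h x in hx
... | true  = dec-true (x ∈? tabulate h) (∈-tabulate⁺ hx)
... | false = dec-false (x ∈? tabulate h) λ x∈ → not-¬ (∈-tabulate⁻ x∈) hx

∈-⋃⁺ : ∀ {n} {x : Fin n} {Ss : List (Subset n)} → Any (x ∈_) Ss → x ∈ ⋃ Ss
∈-⋃⁺ (here x∈S)   = x∈p∪q⁺ (inj₁ x∈S)
∈-⋃⁺ (there x∈Ss) = x∈p∪q⁺ (inj₂ (∈-⋃⁺ x∈Ss))

∈-⋃⁻ : ∀ {n} {x : Fin n} (Ss : List (Subset n)) → x ∈ ⋃ Ss → Any (x ∈_) Ss
∈-⋃⁻ []       x∈⊥ = ⊥-elim (∉⊥ x∈⊥)
∈-⋃⁻ (S ∷ Ss) x∈  with x∈p∪q⁻ S (⋃ Ss) x∈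
... | inj₁ x∈S   = here x∈S
... | inj₂ x∈⋃Ss = there (∈-⋃⁻ Ss x∈⋃Ss)

-- 0 for the empty set.
maxMember : ∀ {n} → Subset n → ℕ
maxMember {n} S = max 0 (map toℕ (filter (_∈? S) (allFin n)))

module _ {n} {S : Subset n} where

  ≤maxMember : ∀ {x} → x ∈ S → toℕ x ≤ maxMember S
  ≤maxMember {x} x∈S = All.lookup (xs≤max 0 _) (∈-map⁺ toℕ (∈-filter⁺ (_∈? S) (∈-allFin x) x∈S))

  maxMember-∈ : ∀ {x} → x ∈ S → ∃ λ y → y ∈ S × toℕ y ≡ maxMember S
  maxMember-∈ {x} x∈S with argmax-sel id 0 (map toℕ (filter (_∈? S) (allFin n)))
  ... | inj₁ max≡0 = x , x∈S , trans (n≤0⇒n≡0 (subst (toℕ x ≤_) max≡0 (≤maxMember x∈S))) (sym max≡0)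
  ... | inj₂ max∈  with ∈-map⁻ toℕ max∈
  ...   | y , y∈ , max≡y = y , proj₂ (∈-filter⁻ (_∈? S) {xs = allFin n} y∈) , sym max≡y

memberℕ : ∀ {n} → Subset n → ℕ → Bool
memberℕ {n} S k with k <? n
... | yes k<n = does (fromℕ< k<n ∈? S)
... | no _    = false

module _ {n} (S : Subset n) where

  memberℕ-in : ∀ {k} (k<n : k < n) → memberℕ S k ≡ does (fromℕ< k<n ∈? S)
  memberℕ-in {k} k<n with k <? n
  ... | yes _   = refl
  ... | no k≮n = ⊥-elim (k≮n k<n)

  memberℕ-out : ∀ {k} → ¬ k < n → memberℕ S k ≡ false
  memberℕ-out {k} k≮n with k <? n
  ... | yes k<n = ⊥-elim (k≮n k<n)
  ... | no _    = refl

  memberℕ-bounded : ∀ {k} → memberℕ S k ≡ true → k < n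
  memberℕ-bounded {k} _ with k <? n
  memberℕ-bounded _ | yes k<n = k<n

  memberℕ-toℕ : ∀ x → memberℕ S (toℕ x) ≡ does (x ∈? S)
  memberℕ-toℕ x = trans (memberℕ-in (toℕ<n x)) (cong (λ y → does (y ∈? S)) (fromℕ<-toℕ x _))

preimage : ∀ {m n} → (Fin m → ℕ) → Subset n → Subset m
preimage f S = tabulate (memberℕ S ∘ f)

module _ {m n} {f : Fin m → ℕ} {S : Subset n} where

  ∈-preimage⁺ : ∀ {a x} → f a ≡ toℕ x → x ∈ S → a ∈ preimage f S
  ∈-preimage⁺ {a} {x} fa≡x x∈S =
    ∈-tabulate⁺ (trans (cong (memberℕ S) fa≡x) (trans (memberℕ-toℕ S x) (dec-true (x ∈? S) x∈S)))

  ∈-preimage⁻ : ∀ {a} → a ∈ preimage f S → ∃ λ x → f a ≡ toℕ x × x ∈ S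
  ∈-preimage⁻ a∈ =
    fromℕ< fa<n , sym (toℕ-fromℕ< fa<n) , does⁻ (fromℕ< fa<n ∈? S) (trans (sym (memberℕ-in S fa<n)) fa∈S)
    where
    fa∈S = ∈-tabulate⁻ a∈
    fa<n = memberℕ-bounded S fa∈S

preimage-injective : ∀ {m n} {f : Fin m → ℕ} → (∀ x → ∃ λ a → f a ≡ toℕ x) →
  ∀ {S S' : Subset n} → preimage f S ≡ preimage f S' → S ≡ S'
preimage-injective {f = f} f-onto e = ⊆-antisym (⊆ e) (⊆ (sym e))
  where
  ⊆ : ∀ {S S'} → preimage f S ≡ preimage f S' → ∀ {x} → x ∈ S → x ∈ S'
  ⊆ {S' = S'} e {x} x∈S with f-onto x
  ... | a , fa≡x with ∈-preimage⁻ (subst (a ∈_) e (∈-preimage⁺ fa≡x x∈S))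
  ...   | y , fa≡y , y∈S' = subst (_∈ S') (toℕ-injective (trans (sym fa≡y) fa≡x)) y∈S'

uses : ∀ {n} → (A → Subset n) → List A → Fin n → ℕ
uses π C x = count (λ R → does (x ∈? π R)) C

uses-preimage≤ : ∀ {m n i} (π : A → Subset n) (f : Fin m → ℕ) (C : List A) →
  (∀ x → uses π C x ≤ i) → ∀ a → uses (preimage f ∘ π) C a ≤ i
uses-preimage≤ {n = n} π f C bound a with f a <? n
... | yes fa<n = ≤-trans (≤-reflexive (count-cong C λ R →
                   trans (does-∈?-tabulate _ a) (memberℕ-in (π R) fa<n)))
                 (bound (fromℕ< fa<n))
... | no fa≮n  = ≤-trans (≤-reflexive (count-none C λ R →
                   subst T (trans (does-∈?-tabulate _ a) (memberℕ-out (π R) fa≮n))))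
                 z≤n

module _ {r c : ℕ} (Y : Diagram r c) where

  memℕ-in : ∀ {s t} (s<r : s < r) (t<c : t < c) → memℕ Y s t ≡ Y (fromℕ< s<r) (fromℕ< t<c)
  memℕ-in {s} {t} s<r t<c with s <? r | t <? c
  ... | yes _  | yes _  = refl
  ... | no s≮r | _      = ⊥-elim (s≮r s<r)
  ... | yes _  | no t≮c = ⊥-elim (t≮c t<c)

  memℕ-bounded : ∀ {s t} → memℕ Y s t ≡ true → s < r × t < c
  memℕ-bounded {s} {t} _ with s <? r | t <? c
  memℕ-bounded _ | yes s<r | yes t<c = s<r , t<c

  memℕ-toℕ : ∀ a b → memℕ Y (toℕ a) (toℕ b) ≡ Y a b
  memℕ-toℕ a b = trans (memℕ-in (toℕ<n a) (toℕ<n b)) (cong₂ Y (fromℕ<-toℕ a _) (fromℕ<-toℕ b _))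

module _ {z : ℕ} where

  Yz≡<ᵇ : ∀ x y → Yz z x y ≡ (toℕ x + toℕ y <ᵇ z)
  Yz≡<ᵇ x y = isYes≗does (toℕ x + toℕ y <? z)

  Yz⁺ : ∀ x y → toℕ x + toℕ y < z → Yz z x y ≡ true
  Yz⁺ x y lt = trans (Yz≡<ᵇ x y) (<ᵇ-true lt)

  Yz⁻ : ∀ x y → Yz z x y ≡ true → toℕ x + toℕ y < z
  Yz⁻ x y e = <ᵇ⇒< _ _ (from T-≡ (trans (sym (Yz≡<ᵇ x y)) e))

  memℕ-Yz : ∀ k l → memℕ (Yz z) k l ≡ (k + l <ᵇ z)
  memℕ-Yz k l with k <? z | l <? z
  ... | yes k<z | yes l<z =
    trans (Yz≡<ᵇ (fromℕ< k<z) (fromℕ< l<z))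
          (cong₂ (λ k′ l′ → k′ + l′ <ᵇ z) (toℕ-fromℕ< k<z) (toℕ-fromℕ< l<z))
  ... | no k≮z  | _       = sym (<ᵇ-false (≤-trans (≮⇒≥ k≮z) (m≤m+n k l)))
  ... | yes _   | no l≮z  = sym (<ᵇ-false (≤-trans (≮⇒≥ l≮z) (m≤n+m l k)))

  antidiagonal : ∀ (m : Fin z) → suc (toℕ m + toℕ (opposite m)) ≡ z
  antidiagonal m = trans (cong (suc (toℕ m) +_) (opposite-prop m)) (m+[n∸m]≡n (toℕ<n m))

-- Steps and ranks of a Young diagram

module StepRanks {r c : ℕ} (Y : Diagram r c) (young : IsYoung Y) where

  memℕ-row-pred : ∀ {s t} → memℕ Y (suc s) t ≡ true → memℕ Y s t ≡ true
  memℕ-row-pred {s} {t} Ys+1t with memℕ-bounded Y Ys+1t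
  ... | s+1<r , t<c = trans (memℕ-in Y s<r t<c)
        (proj₁ young (fromℕ< s+1<r) (fromℕ< s<r) (fromℕ< t<c)
          (trans (cong suc (toℕ-fromℕ< s<r)) (sym (toℕ-fromℕ< s+1<r)))
          (trans (sym (memℕ-in Y s+1<r t<c)) Ys+1t))
    where s<r = ≤-trans (n≤1+n (suc s)) s+1<r

  memℕ-col-pred : ∀ {s t} → memℕ Y s (suc t) ≡ true → memℕ Y s t ≡ true
  memℕ-col-pred {s} {t} Yst+1 with memℕ-bounded Y Yst+1
  ... | s<r , t+1<c = trans (memℕ-in Y s<r t<c)
        (proj₂ young (fromℕ< s<r) (fromℕ< t+1<c) (fromℕ< t<c)
          (trans (cong suc (toℕ-fromℕ< t<c)) (sym (toℕ-fromℕ< t+1<c)))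
          (trans (sym (memℕ-in Y s<r t+1<c)) Yst+1))
    where t<c = ≤-trans (n≤1+n (suc t)) t+1<c

  memℕ-down : ∀ {s t s' t'} → memℕ Y s t ≡ true → s' ≤ s → t' ≤ t → memℕ Y s' t' ≡ true
  memℕ-down Yst s'≤s t'≤t = cols (≤⇒≤′ t'≤t) (rows (≤⇒≤′ s'≤s) Yst)
    where
    rows : ∀ {s s' t} → s' ≤′ s → memℕ Y s t ≡ true → memℕ Y s' t ≡ true
    rows ≤′-refl      = id
    rows (≤′-step le) = rows le ∘ memℕ-row-pred
    cols : ∀ {s t t'} → t' ≤′ t → memℕ Y s t ≡ true → memℕ Y s t' ≡ true
    cols ≤′-refl      = id
    cols (≤′-step le) = cols le ∘ memℕ-col-pred

  IsStepAt : ℕ → ℕ → Set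
  IsStepAt s t = memℕ Y s t ≡ true × memℕ Y (suc s) t ≡ false × memℕ Y s (suc t) ≡ false

  step-maximal : ∀ {s t s' t'} → IsStepAt s t → memℕ Y s' t' ≡ true → s ≤ s' → t ≤ t' →
    s ≡ s' × t ≡ t'
  step-maximal (_ , below∉Y , right∉Y) Ys't' s≤s' t≤t' =
    equal s≤s' (λ s<s' → memℕ-down Ys't' s<s' t≤t') below∉Y ,
    equal t≤t' (λ t<t' → memℕ-down Ys't' s≤s' t<t') right∉Y
    where
    equal : ∀ {m n b} → m ≤ n → (m < n → b ≡ true) → b ≡ false → m ≡ n
    equal m≤n b-if-< b≡false with m≤n⇒m<n∨m≡n m≤n
    ... | inj₁ m<n = ⊥-elim (not-¬ (b-if-< m<n) b≡false)
    ... | inj₂ m≡n = m≡n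

  Cell : Set
  Cell = Fin r × Fin c

  row col : Cell → ℕ
  row = toℕ ∘ proj₁
  col = toℕ ∘ proj₂

  cells : List Cell
  cells = cartesianProduct (allFin r) (allFin c)

  ∈-cells : ∀ p → p ∈ₗ cells
  ∈-cells (a , b) = ∈-cartesianProduct⁺ (∈-allFin a) (∈-allFin b)

  isStep : Cell → Bool
  isStep = isStepᵇ Y

  isStep⁻ : ∀ {p} → T (isStep p) → IsStepAt (row p) (col p)
  isStep⁻ {a , b} h with to T-∧ h
  ... | Yab , notBelowRight with to T-∧ notBelowRight
  ...   | notBelow , notRight =
    trans (memℕ-toℕ Y a b) (to T-≡ Yab) , to T-not-≡ notBelow , to T-not-≡ notRight

  isStep⁺ : ∀ {p} → IsStepAt (row p) (col p) → T (isStep p)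
  isStep⁺ {a , b} (Yab , below∉Y , right∉Y) =
    from T-∧ (from T-≡ (trans (sym (memℕ-toℕ Y a b)) Yab) ,
              from T-∧ (from T-not-≡ below∉Y , from T-not-≡ right∉Y))

  dominating-step : ∀ {s t} → memℕ Y s t ≡ true → ∃ λ p → T (isStep p) × s ≤ row p × t ≤ col p
  dominating-step {s} {t} Yst with ∃-last-true (λ k → memℕ Y k t) r (λ _ → proj₁ ∘ memℕ-bounded Y) Yst
  ... | s' , s≤s' , Ys't , Ys'+1t≡false with ∃-last-true (memℕ Y s') c (λ _ → proj₂ ∘ memℕ-bounded Y) Ys't
  ...   | t' , t≤t' , Ys't' , right∉Y with memℕ-bounded Y Ys't'
  ...     | s'<r , t'<c =
    (fromℕ< s'<r , fromℕ< t'<c) ,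
    isStep⁺ (subst₂ IsStepAt (sym (toℕ-fromℕ< s'<r)) (sym (toℕ-fromℕ< t'<c)) (Ys't' , below∉Y , right∉Y)) ,
    ≤-trans s≤s' (≤-reflexive (sym (toℕ-fromℕ< s'<r))) ,
    ≤-trans t≤t' (≤-reflexive (sym (toℕ-fromℕ< t'<c)))
    where
    below∉Y : memℕ Y (suc s') t' ≡ false
    below∉Y with memℕ Y (suc s') t' in Ys'+1t'
    ... | false = refl
    ... | true  = ⊥-elim (not-¬ (memℕ-down Ys'+1t' ≤-refl t≤t') Ys'+1t≡false)

  ordered-steps-≡ : ∀ {p q} → T (isStep p) → T (isStep q) → row p ≤ row q → col p ≤ col q → p ≡ q
  ordered-steps-≡ {_ , _} {_ , _} p-step q-step ≤row ≤col
    with step-maximal (isStep⁻ p-step) (proj₁ (isStep⁻ q-step)) ≤row ≤col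
  ... | ≡row , ≡col = cong₂ _,_ (toℕ-injective ≡row) (toℕ-injective ≡col)

  sameRow-steps-≡ : ∀ {p q} → T (isStep p) → T (isStep q) → row p ≡ row q → p ≡ q
  sameRow-steps-≡ {p} {q} p-step q-step ≡row with ≤-total (col p) (col q)
  ... | inj₁ ≤col = ordered-steps-≡ p-step q-step (≤-reflexive ≡row) ≤col
  ... | inj₂ ≥col = sym (ordered-steps-≡ q-step p-step (≤-reflexive (sym ≡row)) ≥col)

  sameCol-steps-≡ : ∀ {p q} → T (isStep p) → T (isStep q) → col p ≡ col q → p ≡ q
  sameCol-steps-≡ {p} {q} p-step q-step ≡col with ≤-total (row p) (row q)
  ... | inj₁ ≤row = ordered-steps-≡ p-step q-step ≤row (≤-reflexive ≡col)
  ... | inj₂ ≥row = sym (ordered-steps-≡ q-step p-step ≥row (≤-reflexive (sym ≡col)))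

  stepsBefore : (Cell → ℕ) → ℕ → ℕ
  stepsBefore π k = count (λ p → isStep p ∧ (π p <ᵇ k)) cells

  rowRank colRank : ℕ → ℕ
  rowRank = stepsBefore row
  colRank = stepsBefore col

  numSteps≤rowRank+colRank : ∀ {s t} → memℕ Y s t ≡ false → numSteps Y ≤ rowRank s + colRank t
  numSteps≤rowRank+colRank {s} {t} Yst≡false = begin
    numSteps Y                                               ≡⟨ count-split isStep above cells ⟩
    rowRank s + count (λ p → isStep p ∧ not (above p)) cells ≤⟨ +-monoʳ-≤ (rowRank s) (count-mono cells left) ⟩
    rowRank s + colRank t                                    ∎
    where
    open ≤-Reasoning
    above : Cell → Bool
    above p = row p <ᵇ s
    left : ∀ p → T (isStep p ∧ not (above p)) → T (isStep p ∧ (col p <ᵇ t))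
    left p h with to T-∧ h
    ... | p-step , notAbove = from T-∧ (p-step , <⇒<ᵇ (≰⇒> λ t≤col →
      not-¬ (memℕ-down (proj₁ (isStep⁻ p-step)) (≮ᵇ⇒≥ notAbove) t≤col) Yst≡false))

  rowRank+colRank<numSteps : ∀ {s t} → memℕ Y s t ≡ true → rowRank s + colRank t < numSteps Y
  rowRank+colRank<numSteps {s} {t} Yst = begin-strict
    rowRank s + colRank t                ≡⟨ cong (rowRank s +_) (sym (+-identityʳ (colRank t))) ⟩
    rowRank s + (colRank t + 0)          <⟨ +-monoʳ-< (rowRank s)
                                                  (+-mono-≤-< (count-mono cells leftOnly) dominating) ⟩
    rowRank s + (count (λ p → notAbove p ∧ left p) cells + count (λ p → notAbove p ∧ not (left p)) cells)
                                         ≡⟨ cong (rowRank s +_) (sym (count-split notAbove left cells)) ⟩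
    rowRank s + count notAbove cells     ≡⟨ sym (count-split isStep above cells) ⟩
    numSteps Y                           ∎
    where
    open ≤-Reasoning
    above left notAbove : Cell → Bool
    above p = row p <ᵇ s
    left p = col p <ᵇ t
    notAbove p = isStep p ∧ not (above p)
    leftOnly : ∀ p → T (isStep p ∧ left p) → T (notAbove p ∧ left p)
    leftOnly p h with to T-∧ h
    ... | p-step , isLeft = from T-∧ (from T-∧ (p-step , ≥⇒≮ᵇ s≤row) , isLeft)
      where
      col<t = <ᵇ⇒< _ _ isLeft
      s≤row : s ≤ row p
      s≤row = ≮⇒≥ λ row<s → <⇒≢ col<t (proj₂ (step-maximal (isStep⁻ p-step) Yst (<⇒≤ row<s) (<⇒≤ col<t)))
    dominating : 0 < count (λ p → notAbove p ∧ not (left p)) cells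
    dominating with dominating-step Yst
    ... | p , p-step , s≤row , t≤col =
      count-pos (∈-cells p) (from T-∧ (from T-∧ (p-step , ≥⇒≮ᵇ s≤row) , ≥⇒≮ᵇ t≤col))

  memℕ≡ranks : ∀ s t → memℕ Y s t ≡ (rowRank s + colRank t <ᵇ numSteps Y)
  memℕ≡ranks s t with memℕ Y s t in Yst
  ... | true  = sym (<ᵇ-true (rowRank+colRank<numSteps Yst))
  ... | false = sym (<ᵇ-false (numSteps≤rowRank+colRank Yst))

  module _ (π : Cell → ℕ)
           (π-separates-steps : ∀ {p q} → T (isStep p) → T (isStep q) → π p ≡ π q → p ≡ q) where

    stepsBefore-suc : ∀ k → stepsBefore π (suc k) ≤ suc (stepsBefore π k)
    stepsBefore-suc k = begin
      stepsBefore π (suc k)                 ≡⟨ count-split upTo before cells ⟩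
      count (λ p → upTo p ∧ before p) cells + count (λ p → upTo p ∧ not (before p)) cells
                                            ≤⟨ +-mono-≤ (count-mono cells earlier) (count≤1 cells unique-cells atMostOne) ⟩
      stepsBefore π k + 1                   ≡⟨ +-comm (stepsBefore π k) 1 ⟩
      suc (stepsBefore π k)                 ∎
      where
      open ≤-Reasoning
      upTo before : Cell → Bool
      upTo p = isStep p ∧ (π p <ᵇ suc k)
      before p = π p <ᵇ k
      unique-cells : Unique cells
      unique-cells = Unique.cartesianProduct⁺ (Unique.allFin⁺ r) (Unique.allFin⁺ c)
      earlier : ∀ p → T (upTo p ∧ before p) → T (isStep p ∧ before p)
      earlier p h with to (T-∧ {upTo p}) h
      ... | upToP , isBefore = from T-∧ (proj₁ (to (T-∧ {isStep p}) upToP) , isBefore)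
      stepAtK : ∀ {p} → T (upTo p ∧ not (before p)) → T (isStep p) × π p ≡ k
      stepAtK {p} h with to (T-∧ {upTo p}) h
      ... | upToP , notBefore with to (T-∧ {isStep p}) upToP
      ...   | p-step , beforeSuc = p-step , ≤-antisym (s≤s⁻¹ (<ᵇ⇒< _ _ beforeSuc)) (≮ᵇ⇒≥ notBefore)
      atMostOne : ∀ {p q} → T (upTo p ∧ not (before p)) → T (upTo q ∧ not (before q)) → p ≡ q
      atMostOne hp hq with stepAtK hp | stepAtK hq
      ... | p-step , πp≡k | q-step , πq≡k = π-separates-steps p-step q-step (trans πp≡k (sym πq≡k))

    stepsBefore-onto : ∀ n → (∀ p → π p < n) →
      ∀ {k} → k < numSteps Y → ∃ λ s → s < n × stepsBefore π s ≡ k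
    stepsBefore-onto n π<n k<numSteps = discrete-ivt (stepsBefore π) n stepsBefore-suc
      (≤-trans (≤-reflexive (count-none cells λ p → subst T (∧-zeroʳ (isStep p)))) z≤n)
      (≤-trans k<numSteps (count-mono cells λ p p-step → from T-∧ (p-step , <⇒<ᵇ (π<n p))))

  Y≡Yz∘ranks : ∀ a b → Y a b ≡ memℕ (Yz (numSteps Y)) (rowRank (toℕ a)) (colRank (toℕ b))
  Y≡Yz∘ranks a b = trans (sym (memℕ-toℕ Y a b)) (trans (memℕ≡ranks _ _) (sym (memℕ-Yz {numSteps Y} _ _)))

  rowRank-onto : ∀ (x : Fin (numSteps Y)) → ∃ λ (a : Fin r) → rowRank (toℕ a) ≡ toℕ x
  rowRank-onto x with stepsBefore-onto row sameRow-steps-≡ r (toℕ<n ∘ proj₁) (toℕ<n x)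
  ... | s , s<r , rank≡x = fromℕ< s<r , trans (cong rowRank (toℕ-fromℕ< s<r)) rank≡x

  colRank-onto : ∀ (y : Fin (numSteps Y)) → ∃ λ (b : Fin c) → colRank (toℕ b) ≡ toℕ y
  colRank-onto y with stepsBefore-onto col sameCol-steps-≡ c (toℕ<n ∘ proj₂) (toℕ<n y)
  ... | t , t<c , rank≡y = fromℕ< t<c , trans (cong colRank (toℕ-fromℕ< t<c)) rank≡y

  rowSection colSection : Fin (numSteps Y) → ℕ
  rowSection = toℕ ∘ proj₁ ∘ rowRank-onto
  colSection = toℕ ∘ proj₁ ∘ colRank-onto

  Yz≡Y∘sections : ∀ x y → Yz (numSteps Y) x y ≡ memℕ Y (rowSection x) (colSection y)
  Yz≡Y∘sections x y = trans (Yz≡<ᵇ x y) (trans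
    (cong₂ (λ k l → k + l <ᵇ numSteps Y) (sym (proj₂ (rowRank-onto x))) (sym (proj₂ (colRank-onto y))))
    (sym (memℕ≡ranks _ _)))

-- Pulling back covers

record IsLocalMulticover (i j : ℕ) {r c : ℕ} (Y : Diagram r c) (C : List (Rect r c)) : Set where
  field
    inside   : All (IsRectIn Y) C
    covers   : ∀ a b → Y a b ≡ true → Any (λ R → a ∈ proj₁ R × b ∈ proj₂ R) C
    rowBound : ∀ a → rowUse C a ≤ i
    colBound : ∀ b → colUse C b ≤ j

module _ {i j r c : ℕ} {Y : Diagram r c} {C : List (Rect r c)} where

  localCover⇒multicover : IsLocalCover i j Y C → IsLocalMulticover i j Y C
  localCover⇒multicover ((_ , inside , covers) , rowBound , colBound) = record
    { inside = inside ; covers = covers ; rowBound = rowBound ; colBound = colBound }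

  multicover⇒localCover : Unique C → IsLocalMulticover i j Y C → IsLocalCover i j Y C
  multicover⇒localCover unique cover = (unique , inside , covers) , rowBound , colBound
    where open IsLocalMulticover cover

module Pullback {m m' n n' : ℕ} (Y' : Diagram m m') (Y : Diagram n n')
  (f : Fin m → ℕ) (g : Fin m' → ℕ) (Y'≡Y∘fg : ∀ a b → Y' a b ≡ memℕ Y (f a) (g b)) where

  pullback : Rect n n' → Rect m m'
  pullback R = preimage f (proj₁ R) , preimage g (proj₂ R)

  pullback-inside : ∀ {R} → IsRectIn Y R → IsRectIn Y' (pullback R)
  pullback-inside R⊆Y a b a∈ b∈ with ∈-preimage⁻ a∈ | ∈-preimage⁻ b∈
  ... | x , fa≡x , x∈ | y , gb≡y , y∈ =
    trans (Y'≡Y∘fg a b) (trans (cong₂ (memℕ Y) fa≡x gb≡y) (trans (memℕ-toℕ Y x y) (R⊆Y x y x∈ y∈)))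

  pullback-covers : ∀ {C} → (∀ x y → Y x y ≡ true → Any (λ R → x ∈ proj₁ R × y ∈ proj₂ R) C) →
    ∀ a b → Y' a b ≡ true → Any (λ R → a ∈ proj₁ R × b ∈ proj₂ R) (map pullback C)
  pullback-covers covers a b Y'ab = Any.map⁺ (Any.map
    (λ (x∈ , y∈) → ∈-preimage⁺ (sym (toℕ-fromℕ< fa<n)) x∈ , ∈-preimage⁺ (sym (toℕ-fromℕ< gb<n')) y∈)
    (covers _ _ (trans (sym (memℕ-in Y fa<n gb<n')) Yfagb)))
    where
    Yfagb = trans (sym (Y'≡Y∘fg a b)) Y'ab
    fa<n = proj₁ (memℕ-bounded Y Yfagb)
    gb<n' = proj₂ (memℕ-bounded Y Yfagb)

  pullback-multicover : ∀ {i j C} → IsLocalMulticover i j Y C → IsLocalMulticover i j Y' (map pullback C)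
  pullback-multicover {C = C} cover = record
    { inside   = All.map⁺ (All.map pullback-inside inside)
    ; covers   = pullback-covers covers
    ; rowBound = λ a → ≤-trans (≤-reflexive (count-map _ pullback C)) (uses-preimage≤ proj₁ f C rowBound a)
    ; colBound = λ b → ≤-trans (≤-reflexive (count-map _ pullback C)) (uses-preimage≤ proj₂ g C colBound b)
    }
    where open IsLocalMulticover cover

  pullback-injective : (∀ x → ∃ λ a → f a ≡ toℕ x) → (∀ y → ∃ λ b → g b ≡ toℕ y) →
    ∀ {R R'} → pullback R ≡ pullback R' → R ≡ R'
  pullback-injective f-onto g-onto e =
    cong₂ _,_ (preimage-injective f-onto (cong proj₁ e)) (preimage-injective g-onto (cong proj₂ e))

-- Regrouping a cover of the staircase into exactly z rectangles

HasTightStaircaseCover : ℕ → ℕ → ℕ → Set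
HasTightStaircaseCover i j z = Σ (List (Rect z z)) λ C → IsLocalCover i j (Yz z) C × length C ≡ z

module Normalise {z i j : ℕ} {D : List (Rect z z)} (D-cover : IsLocalMulticover i j (Yz z) D) where
  open IsLocalMulticover D-cover

  IsLastRow : Fin z → Rect z z → Set
  IsLastRow m R = m ∈ proj₁ R × toℕ m ≡ maxMember (proj₁ R)

  isLastRow? : ∀ m R → Dec (IsLastRow m R)
  isLastRow? m R = (m ∈? proj₁ R) ×-dec (toℕ m ≟ maxMember (proj₁ R))

  inside-D : ∀ {R x y} → R ∈ₗ D → x ∈ proj₁ R → y ∈ proj₂ R → toℕ x + toℕ y < z
  inside-D {x = x} {y} R∈D x∈ y∈ = Yz⁻ x y (All.lookup inside R∈D _ _ x∈ y∈)

  blockSide : (Rect z z → Subset z) → Fin z → Subset z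
  blockSide π m = ⋃ (map π (filter (isLastRow? m) D))

  module _ (π : Rect z z → Subset z) (m : Fin z) {x : Fin z} where

    ∈-blockSide⁺ : ∀ {R} → R ∈ₗ D → IsLastRow m R → x ∈ π R → x ∈ blockSide π m
    ∈-blockSide⁺ R∈D last x∈ = ∈-⋃⁺ (Any.map⁺ (lose (∈-filter⁺ (isLastRow? m) R∈D last) x∈))

    ∈-blockSide⁻ : x ∈ blockSide π m → ∃ λ R → R ∈ₗ D × IsLastRow m R × x ∈ π R
    ∈-blockSide⁻ x∈ with find (Any.map⁻ (∈-⋃⁻ (map π (filter (isLastRow? m) D)) x∈))
    ... | R , R∈ , x∈πR with ∈-filter⁻ (isLastRow? m) {xs = D} R∈
    ...   | R∈D , last = R , R∈D , last , x∈πR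

  block : Fin z → Rect z z
  block m = blockSide proj₁ m , blockSide proj₂ m

  blockRow≤ : ∀ {m x} → x ∈ blockSide proj₁ m → toℕ x ≤ toℕ m
  blockRow≤ {m} x∈ with ∈-blockSide⁻ proj₁ m x∈
  ... | _ , _ , (_ , m≡max) , x∈R = ≤-trans (≤maxMember x∈R) (≤-reflexive (sym m≡max))

  -- Every column y of block m comes from a rectangle containing row m, so x ≤ m gives x + y ≤ m + y < z.
  block-inside : ∀ m → IsRectIn (Yz z) (block m)
  block-inside m x y x∈ y∈ with ∈-blockSide⁻ proj₂ m y∈
  ... | R , R∈D , (m∈R , _) , y∈R =
    Yz⁺ x y (≤-<-trans (+-monoˡ-≤ (toℕ y) (blockRow≤ x∈)) (inside-D R∈D m∈R y∈R))

  -- The cell (m, z-1-m) on the antidiagonal lies in a rectangle whose last row must be m.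
  diagonal : ∀ m → m ∈ blockSide proj₁ m
  diagonal m with find (covers m (opposite m) (Yz⁺ m (opposite m) (≤-reflexive (antidiagonal m))))
  ... | R , R∈D , m∈R , opp∈R with maxMember-∈ m∈R
  ...   | m' , m'∈R , m'≡max = ∈-blockSide⁺ proj₁ m R∈D (m∈R , ≤-antisym (≤maxMember m∈R) max≤m) m∈R
    where
    max≤m : maxMember (proj₁ R) ≤ toℕ m
    max≤m = subst (_≤ toℕ m) m'≡max (+-cancelʳ-≤ (toℕ (opposite m)) _ _
              (s≤s⁻¹ (≤-trans (inside-D R∈D m'∈R opp∈R) (≤-reflexive (sym (antidiagonal m))))))

  block-injective : ∀ {m m'} → block m ≡ block m' → m ≡ m'
  block-injective {m} {m'} e = toℕ-injective (≤-antisym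
    (blockRow≤ (subst (m ∈_) (cong proj₁ e) (diagonal m)))
    (blockRow≤ (subst (m' ∈_) (cong proj₁ (sym e)) (diagonal m'))))

  blocks : List (Rect z z)
  blocks = map block (allFin z)

  blocks-cover : ∀ x y → Yz z x y ≡ true → Any (λ B → x ∈ proj₁ B × y ∈ proj₂ B) blocks
  blocks-cover x y Yxy with find (covers x y Yxy)
  ... | R , R∈D , x∈R , y∈R with maxMember-∈ {S = proj₁ R} x∈R
  ...   | m , m∈R , m≡max = Any.map⁺ (lose (∈-allFin m)
    (∈-blockSide⁺ proj₁ m R∈D (m∈R , m≡max) x∈R , ∈-blockSide⁺ proj₂ m R∈D (m∈R , m≡max) y∈R))

  blockSide-uses : ∀ π x → count (λ m → does (x ∈? blockSide π m)) (allFin z) ≤ uses π D x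
  blockSide-uses π x = count≤count-via {p = λ m → does (x ∈? blockSide π m)} {q = λ R → does (x ∈? π R)}
    toℕ (maxMember ∘ proj₁) toℕ-injective (Unique.allFin⁺ z) witness
    where
    witness : ∀ {m} → m ∈ₗ allFin z → T (does (x ∈? blockSide π m)) →
      ∃ λ R → R ∈ₗ D × T (does (x ∈? π R)) × maxMember (proj₁ R) ≡ toℕ m
    witness {m} _ x∈ with ∈-blockSide⁻ π m (does⁻ (x ∈? blockSide π m) (to T-≡ x∈))
    ... | R , R∈D , (_ , m≡max) , x∈R = R , R∈D , from T-≡ (dec-true (x ∈? π R) x∈R) , sym m≡max

  blocks-multicover : IsLocalMulticover i j (Yz z) blocks
  blocks-multicover = record
    { inside   = All.map⁺ (All.universal block-inside (allFin z))
    ; covers   = blocks-cover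
    ; rowBound = λ x → ≤-trans (≤-reflexive (count-map _ block (allFin z)))
                               (≤-trans (blockSide-uses proj₁ x) (rowBound x))
    ; colBound = λ y → ≤-trans (≤-reflexive (count-map _ block (allFin z)))
                               (≤-trans (blockSide-uses proj₂ y) (colBound y))
    }

  normalise : HasTightStaircaseCover i j z
  normalise =
    blocks ,
    multicover⇒localCover (Unique.map⁺ block-injective (Unique.allFin⁺ z)) blocks-multicover ,
    trans (length-map block (allFin z)) (length-tabulate id)

module _ {i j r c : ℕ} (Y : Diagram r c) (young : IsYoung Y) where
  open StepRanks Y young

  localCover⇒tightStaircaseCover : HasLocalCover i j Y → HasTightStaircaseCover i j (numSteps Y)
  localCover⇒tightStaircaseCover (_ , cover) = Normalise.normalise
    (Pullback.pullback-multicover (Yz (numSteps Y)) Y rowSection colSection Yz≡Y∘sections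
      (localCover⇒multicover cover))

  tightStaircaseCover⇒localCover : HasTightStaircaseCover i j (numSteps Y) → HasLocalCover i j Y
  tightStaircaseCover⇒localCover (C , cover@((unique , _) , _) , _) =
    map pullback C ,
    multicover⇒localCover (Unique.map⁺ (pullback-injective rowRank-onto colRank-onto) unique)
                          (pullback-multicover (localCover⇒multicover cover))
    where open Pullback Y (Yz (numSteps Y)) (rowRank ∘ toℕ) (colRank ∘ toℕ) Y≡Yz∘ranks

lemma2 : (i j z : ℕ) → 1 ≤ i → 1 ≤ j → 1 ≤ z →
    (r c : ℕ) (Y : Diagram r c) → IsYoung Y → numSteps Y ≡ z →
    (HasLocalCover i j Y ⇔
      Σ (List (Rect z z)) (λ C → IsLocalCover i j (Yz z) C × length C ≡ z))
lemma2 i j _ _ _ _ r c Y young refl =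
  mk⇔ (localCover⇒tightStaircaseCover Y young) (tightStaircaseCover⇒localCover Y young)
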